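{- Let $n\ge 1$ and $m\ge 0$ be integers. The number of signed permutations $\pi\in B_n$ with exactly $m$ pn-descents is $n!\binom{n+1}{n-2m}$ (where $\binom{a}{b}=0$ if $b<0$).
   Context: $B_n$ is the hyperoctahedral group, viewed as the set of signed permutations: words $\pi=\pi_1\pi_2\cdots\pi_n$ with each $\pi_i\in\{1,\dots,n,\bar1,\dots,\bar n\}$ such that $|\pi_1|\cdots|\pi_n|$ is a permutation of $\{1,\dots,n\}$ (here $|i|=|\bar i|=i$). Letters $1,\dots,n$ are called positive and $\bar1,\dots,\bar n$ negative, with the order $\bar1<\bar2<\cdots<\bar n<1<2<\cdots<n$. The permutation $\pi$ has a pn-descent at index $i\in\{1,\dots,n-1\}$ if $\pi_i$ is positive and $\pi_{i+1}$ is negative. -}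

module Defs where

open import Data.Nat using (ℕ; zero; suc; _+_; _*_; _∸_; _≤ᵇ_; _!)
open import Data.Nat.Combinatorics using (_C_)
open import Data.Fin using (Fin; zero; suc; _≟_)
open import Data.Bool using (Bool; true; false; _∧_; not; if_then_else_)
open import Data.Product using (_×_; _,_; proj₁; proj₂)
open import Data.Vec using (Vec; []; _∷_; map; toList)
open import Data.List using (List; []; _∷_)
open import Relation.Nullary.Decidable using (⌊_⌋)

-- A letter of a signed permutation: (|π_i| as an element of Fin n, sign),
-- sign true = positive letter, false = negative (barred) letter.
Letter : ℕ → Set
Letter n = Fin n × Bool

allᵇ : ∀ {A : Set} → (A → Bool) → List A → Bool
allᵇ p [] = true
allᵇ p (x ∷ xs) = p x ∧ allᵇ p xs

distinctᵇ : ∀ {n} → List (Fin n) → Bool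
distinctᵇ [] = true
distinctᵇ (x ∷ xs) = allᵇ (λ y → not ⌊ x ≟ y ⌋) xs ∧ distinctᵇ xs

-- A word of length n over Letter n is a signed permutation iff |π_1|⋯|π_n|
-- is a permutation of {1..n}, i.e. (n letters from an n-set) all distinct.
isSignedPermᵇ : ∀ {n} → Vec (Letter n) n → Bool
isSignedPermᵇ w = distinctᵇ (toList (map proj₁ w))

pnDesList : ∀ {n} → List (Letter n) → ℕ
pnDesList [] = 0
pnDesList (x ∷ []) = 0
pnDesList (x ∷ y ∷ ys) =
  (if proj₂ x ∧ not (proj₂ y) then 1 else 0) + pnDesList (y ∷ ys)

pnDes : ∀ {n} → Vec (Letter n) n → ℕ
pnDes w = pnDesList (toList w)

binomShift : ℕ → ℕ → ℕ
binomShift n m = if (2 * m) ≤ᵇ n then (suc n) C (n ∸ 2 * m) else 0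

-- A signed permutation is a permutation |π| together with a sign word, and pn-descents
-- only see the signs, so the count is n! times the number of sign words of length n with
-- m pn-descents. Read the sign word as b₀ s₁ ⋯ sₙ b_{n+1} with b₀ negative and b_{n+1}
-- positive: every pn-descent is followed by exactly one later return to positive, so the
-- word has exactly 2m + 1 sign changes, and these may sit in any 2m + 1 of the n + 1 gaps.
module Submission where

open import Defs
open import Data.Nat using (ℕ; zero; suc; _+_; _*_; _≥_; _!; _≤ᵇ_; s≤s)
open import Data.Nat.Properties using (≡-irrelevant; suc-injective; *-suc; ≤ᵇ⇒≤; ≤⇒≤ᵇ; ≰⇒>)
open import Data.Nat.Combinatorics using (_C_; nCk≡nC[n∸k]; nCk+nC[k+1]≡[n+1]C[k+1])
open import Data.Nat.Combinatorics.Specification using (k>n⇒nCk≡0)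
open import Data.Fin using (Fin; zero; punchIn; punchOut; _≟_)
open import Data.Fin.Properties
  using (punchIn-punchOut; punchOut-punchIn; punchInᵢ≢i; punchIn-injective; punchOut-cong; *↔×; +↔⊎)
open import Data.Vec using (Vec; []; _∷_; map; toList; zip)
open import Data.Vec.Properties using (map-proj₁-zip; map-proj₂-zip)
open import Data.Bool using (Bool; true; false; T; not; _∧_; if_then_else_)
open import Data.Bool.Properties using (T-irrelevant; T-∧)
open import Data.Product using (Σ; _×_; _,_; proj₁; proj₂)
open import Data.Product.Algebra using (×-cong)
open import Data.Product.Function.Dependent.Propositional using (Σ-↔)
open import Data.Sum using (_⊎_; inj₁; inj₂)
open import Data.Sum.Algebra using (⊎-cong; ⊎-comm)
open import Data.Empty using (⊥-elim)
open import Data.Unit using (tt)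
open import Relation.Nullary using (Irrelevant; yes; no)
open import Relation.Nullary.Decidable using (⌊_⌋)
open import Relation.Binary.PropositionalEquality using (_≡_; refl; sym; trans; cong; cong₂; subst)
open import Function.Bundles using (_⤖_; _↔_; mk↔ₛ′; Equivalence)
open import Function.Properties.Inverse using (↔-refl; ↔-trans; ↔-sym; ↔⇒⤖)
open import Function.Related.Propositional using (K-reflexive; module EquationalReasoning)

open EquationalReasoning

Σ-prop-≡ : ∀ {A : Set} {P : A → Set} → (∀ {a} → Irrelevant (P a)) →
           ∀ {a b} {p : P a} {q : P b} → a ≡ b → _≡_ {A = Σ A P} (a , p) (b , q)
Σ-prop-≡ irr {p = p} {q} refl = cong (_ ,_) (irr p q)

×-irrelevant : ∀ {A B : Set} → Irrelevant A → Irrelevant B → Irrelevant (A × B)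
×-irrelevant irrA irrB (a , b) (a′ , b′) = cong₂ _,_ (irrA a a′) (irrB b b′)

Fin-cong : ∀ {a b} → a ≡ b → Fin a ↔ Fin b
Fin-cong eq = K-reflexive (cong Fin eq)

zip-map-proj : ∀ {A B : Set} {n} (w : Vec (A × B) n) → zip (map proj₁ w) (map proj₂ w) ≡ w
zip-map-proj []      = refl
zip-map-proj (x ∷ w) = cong (x ∷_) (zip-map-proj w)

Σ-unzip-↔ : ∀ {A B : Set} {n} {P : Vec A n → Set} {Q : Vec B n → Set} →
            (∀ {u} → Irrelevant (P u)) → (∀ {s} → Irrelevant (Q s)) →
            Σ (Vec (A × B) n) (λ w → P (map proj₁ w) × Q (map proj₂ w)) ↔ (Σ (Vec A n) P × Σ (Vec B n) Q)
Σ-unzip-↔ {A} {B} {n} {P} {Q} irrP irrQ = mk↔ₛ′ to from to∘from from∘to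
  where
  to : Σ (Vec (A × B) n) (λ w → P (map proj₁ w) × Q (map proj₂ w)) → Σ (Vec A n) P × Σ (Vec B n) Q
  to (w , p , q) = (map proj₁ w , p) , (map proj₂ w , q)
  from : Σ (Vec A n) P × Σ (Vec B n) Q → Σ (Vec (A × B) n) (λ w → P (map proj₁ w) × Q (map proj₂ w))
  from ((u , p) , (s , q)) =
    zip u s , subst P (sym (map-proj₁-zip u s)) p , subst Q (sym (map-proj₂-zip u s)) q
  to∘from : ∀ y → to (from y) ≡ y
  to∘from ((u , p) , (s , q)) = cong₂ _,_ (Σ-prop-≡ irrP (map-proj₁-zip u s)) (Σ-prop-≡ irrQ (map-proj₂-zip u s))
  from∘to : ∀ x → from (to x) ≡ x
  from∘to (w , _) = Σ-prop-≡ (×-irrelevant irrP irrQ) (zip-map-proj w)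

Σ-Vec-∷-↔ : ∀ {A : Set} {n} {P : Vec A (suc n) → Set} →
            Σ (Vec A (suc n)) P ↔ Σ A (λ x → Σ (Vec A n) (λ s → P (x ∷ s)))
Σ-Vec-∷-↔ = mk↔ₛ′ (λ { (x ∷ s , p) → x , s , p }) (λ { (x , s , p) → x ∷ s , p })
                  (λ _ → refl) (λ { (_ ∷ _ , _) → refl })

Σ-Bool-↔ : ∀ {F : Bool → Set} → Σ Bool F ↔ (F true ⊎ F false)
Σ-Bool-↔ = mk↔ₛ′ (λ { (true , p) → inj₁ p ; (false , p) → inj₂ p })
                 (λ { (inj₁ p) → true , p ; (inj₂ p) → false , p })
                 (λ { (inj₁ _) → refl ; (inj₂ _) → refl })
                 (λ { (true , _) → refl ; (false , _) → refl })

avoidsᵇ : ∀ {n k} → Fin n → Vec (Fin n) k → Bool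
avoidsᵇ x v = allᵇ (λ y → not ⌊ x ≟ y ⌋) (toList v)

Distinct : ∀ {n k} → Vec (Fin n) k → Set
Distinct v = T (distinctᵇ (toList v))

DistinctVec : ℕ → ℕ → Set
DistinctVec n k = Σ (Vec (Fin n) k) Distinct

Avoiding : ∀ {n} → Fin (suc n) → ℕ → Set
Avoiding {n} x k = Σ (Vec (Fin (suc n)) k) (λ v → T (avoidsᵇ x v) × Distinct v)

punchOutAll : ∀ {n k} (x : Fin (suc n)) (v : Vec (Fin (suc n)) k) → T (avoidsᵇ x v) → Vec (Fin n) k
punchOutAll x []      _ = []
punchOutAll x (y ∷ v) p with x ≟ y
... | yes _  = ⊥-elim p
... | no x≢y = punchOut x≢y ∷ punchOutAll x v p

avoids-map-punchIn : ∀ {n k} (x : Fin (suc n)) (u : Vec (Fin n) k) → T (avoidsᵇ x (map (punchIn x) u))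
avoids-map-punchIn x []      = tt
avoids-map-punchIn x (y ∷ u) with x ≟ punchIn x y
... | yes eq = ⊥-elim (punchInᵢ≢i x y (sym eq))
... | no _   = avoids-map-punchIn x u

punchOutAll-map-punchIn : ∀ {n k} (x : Fin (suc n)) (u : Vec (Fin n) k) (p : T (avoidsᵇ x (map (punchIn x) u))) →
                          punchOutAll x (map (punchIn x) u) p ≡ u
punchOutAll-map-punchIn x []      p = refl
punchOutAll-map-punchIn x (y ∷ u) p with x ≟ punchIn x y
... | yes _ = ⊥-elim p
... | no _  = cong₂ _∷_ (trans (punchOut-cong x refl) (punchOut-punchIn x)) (punchOutAll-map-punchIn x u p)

map-punchIn-punchOutAll : ∀ {n k} (x : Fin (suc n)) (v : Vec (Fin (suc n)) k) (p : T (avoidsᵇ x v)) →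
                          map (punchIn x) (punchOutAll x v p) ≡ v
map-punchIn-punchOutAll x []      p = refl
map-punchIn-punchOutAll x (y ∷ v) p with x ≟ y
... | yes _  = ⊥-elim p
... | no x≢y = cong₂ _∷_ (punchIn-punchOut x≢y) (map-punchIn-punchOutAll x v p)

avoids-map⁻ : ∀ {a b k} (f : Fin a → Fin b) y (u : Vec (Fin a) k) → T (avoidsᵇ (f y) (map f u)) → T (avoidsᵇ y u)
avoids-map⁻ f y []      p = tt
avoids-map⁻ f y (z ∷ u) p with y ≟ z | f y ≟ f z
... | yes refl | yes _  = p
... | yes refl | no fy≢fy = ⊥-elim (fy≢fy refl)
... | no _     | yes _  = ⊥-elim p
... | no _     | no _   = avoids-map⁻ f y u p

avoids-map⁺ : ∀ {a b k} (f : Fin a → Fin b) → (∀ i j → f i ≡ f j → i ≡ j) →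
              ∀ y (u : Vec (Fin a) k) → T (avoidsᵇ y u) → T (avoidsᵇ (f y) (map f u))
avoids-map⁺ f inj y []      p = tt
avoids-map⁺ f inj y (z ∷ u) p with y ≟ z | f y ≟ f z
... | yes _  | _     = ⊥-elim p
... | no y≢z | yes e = ⊥-elim (y≢z (inj y z e))
... | no _   | no _  = avoids-map⁺ f inj y u p

distinct-map⁻ : ∀ {a b k} (f : Fin a → Fin b) (u : Vec (Fin a) k) → Distinct (map f u) → Distinct u
distinct-map⁻ f []      p = tt
distinct-map⁻ f (z ∷ u) p with Equivalence.to T-∧ p
... | p₁ , p₂ = Equivalence.from T-∧ (avoids-map⁻ f z u p₁ , distinct-map⁻ f u p₂)

distinct-map⁺ : ∀ {a b k} (f : Fin a → Fin b) → (∀ i j → f i ≡ f j → i ≡ j) →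
                (u : Vec (Fin a) k) → Distinct u → Distinct (map f u)
distinct-map⁺ f inj []      p = tt
distinct-map⁺ f inj (z ∷ u) p with Equivalence.to T-∧ p
... | p₁ , p₂ = Equivalence.from T-∧ (avoids-map⁺ f inj z u p₁ , distinct-map⁺ f inj u p₂)

avoiding↔distinctVec : ∀ {n} (x : Fin (suc n)) k → Avoiding x k ↔ DistinctVec n k
avoiding↔distinctVec x k = mk↔ₛ′ to from to∘from from∘to
  where
  to : Avoiding x k → DistinctVec _ k
  to (v , a , d) = punchOutAll x v a ,
    distinct-map⁻ (punchIn x) (punchOutAll x v a) (subst Distinct (sym (map-punchIn-punchOutAll x v a)) d)
  from : DistinctVec _ k → Avoiding x k
  from (u , d) = map (punchIn x) u , avoids-map-punchIn x u , distinct-map⁺ (punchIn x) (punchIn-injective x) u d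
  to∘from : ∀ y → to (from y) ≡ y
  to∘from (u , _) = Σ-prop-≡ T-irrelevant (punchOutAll-map-punchIn x u (avoids-map-punchIn x u))
  from∘to : ∀ y → from (to y) ≡ y
  from∘to (v , a , _) = Σ-prop-≡ (×-irrelevant T-irrelevant T-irrelevant) (map-punchIn-punchOutAll x v a)

distinctVec-suc-↔ : ∀ n k → DistinctVec (suc n) (suc k) ↔ (Fin (suc n) × DistinctVec n k)
distinctVec-suc-↔ n k = ↔-trans splitHead (Σ-↔ ↔-refl (avoiding↔distinctVec _ k))
  where
  splitHead : DistinctVec (suc n) (suc k) ↔ Σ (Fin (suc n)) (λ x → Avoiding x k)
  splitHead = mk↔ₛ′ (λ { (x ∷ v , p) → x , v , Equivalence.to T-∧ p })
                    (λ { (x , v , q) → x ∷ v , Equivalence.from T-∧ q })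
                    (λ { (x , v , _) → cong (λ q → x , v , q) (×-irrelevant T-irrelevant T-irrelevant _ _) })
                    (λ { (x ∷ v , _) → cong (x ∷ v ,_) (T-irrelevant _ _) })

permutations↔ : ∀ n → DistinctVec n n ↔ Fin (n !)
permutations↔ zero    = mk↔ₛ′ (λ _ → zero) (λ _ → [] , tt) (λ { zero → refl }) (λ { ([] , tt) → refl })
permutations↔ (suc n) =
  ↔-trans (distinctVec-suc-↔ n n) (↔-trans (×-cong ↔-refl (permutations↔ n)) (↔-sym *↔×))

pnDesFrom : ∀ {k} → Bool → Vec Bool k → ℕ
pnDesFrom b []      = 0
pnDesFrom b (x ∷ s) = (if b ∧ not x then 1 else 0) + pnDesFrom x s

SignWords : ℕ → Bool → ℕ → Set
SignWords n b m = Σ (Vec Bool n) (λ s → pnDesFrom b s ≡ m)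

double : ℕ → ℕ
double zero    = zero
double (suc m) = suc (suc (double m))

-- The number of sign changes of b s₁ ⋯ sₙ true when b s₁ ⋯ sₙ has m pn-descents.
signChanges : Bool → ℕ → ℕ
signChanges true  m = double m
signChanges false m = suc (double m)

Fin-pascal-↔ : ∀ n k → (Fin (n C k) ⊎ Fin (n C suc k)) ↔ Fin (suc n C suc k)
Fin-pascal-↔ n k = ↔-trans (↔-sym +↔⊎) (Fin-cong (nCk+nC[k+1]≡[n+1]C[k+1] n k))

signWords-∷-↔ : ∀ n b m → SignWords (suc n) b m ↔
  (Σ (Vec Bool n) (λ s → pnDesFrom b (true ∷ s) ≡ m) ⊎ Σ (Vec Bool n) (λ s → pnDesFrom b (false ∷ s) ≡ m))
signWords-∷-↔ n b m = ↔-trans Σ-Vec-∷-↔ Σ-Bool-↔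

Σ-suc≡suc-↔ : ∀ n b m → Σ (Vec Bool n) (λ s → suc (pnDesFrom b s) ≡ suc m) ↔ SignWords n b m
Σ-suc≡suc-↔ n b m = Σ-↔ ↔-refl (mk↔ₛ′ suc-injective (cong suc) (λ _ → ≡-irrelevant _ _) (λ _ → ≡-irrelevant _ _))

Σ-suc≡0-↔ : ∀ n b → Σ (Vec Bool n) (λ s → suc (pnDesFrom b s) ≡ 0) ↔ Fin 0
Σ-suc≡0-↔ n b = mk↔ₛ′ (λ { (_ , ()) }) (λ ()) (λ ()) (λ { (_ , ()) })

signWords-0-zero-↔ : ∀ {b} → SignWords 0 b 0 ↔ Fin 1
signWords-0-zero-↔ = mk↔ₛ′ (λ _ → zero) (λ _ → [] , refl) (λ { zero → refl }) (λ { ([] , refl) → refl })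

signWords-0-suc-↔ : ∀ {b m} → SignWords 0 b (suc m) ↔ Fin 0
signWords-0-suc-↔ = mk↔ₛ′ (λ { ([] , ()) }) (λ ()) (λ ()) (λ { ([] , ()) })

signWords↔ : ∀ n b m → SignWords n b m ↔ Fin (suc n C signChanges b m)
signWords↔ zero true  zero    = signWords-0-zero-↔
signWords↔ zero false zero    = signWords-0-zero-↔
signWords↔ zero true  (suc m) = signWords-0-suc-↔
signWords↔ zero false (suc m) = signWords-0-suc-↔
signWords↔ (suc n) false m = begin
  SignWords (suc n) false m                                         ↔⟨ signWords-∷-↔ n false m ⟩
  (SignWords n true m ⊎ SignWords n false m)                        ↔⟨ ⊎-cong (signWords↔ n true m) (signWords↔ n false m) ⟩
  (Fin (suc n C signChanges true m) ⊎ Fin (suc n C signChanges false m)) ↔⟨ Fin-pascal-↔ (suc n) (signChanges true m) ⟩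
  Fin (suc (suc n) C signChanges false m)                           ∎
signWords↔ (suc n) true zero = begin
  SignWords (suc n) true zero                                       ↔⟨ signWords-∷-↔ n true zero ⟩
  (SignWords n true zero ⊎ _)                                       ↔⟨ ⊎-cong (signWords↔ n true zero) (Σ-suc≡0-↔ n false) ⟩
  (Fin 1 ⊎ Fin 0)                                                   ↔⟨ +↔⊎ ⟨
  Fin 1                                                             ∎
signWords↔ (suc n) true (suc m) = begin
  SignWords (suc n) true (suc m)                                    ↔⟨ signWords-∷-↔ n true (suc m) ⟩
  (SignWords n true (suc m) ⊎ _)                                    ↔⟨ ⊎-comm _ _ ⟩
  (_ ⊎ SignWords n true (suc m))                                    ↔⟨ ⊎-cong (Σ-suc≡suc-↔ n false m) ↔-refl ⟩
  (SignWords n false m ⊎ SignWords n true (suc m))                  ↔⟨ ⊎-cong (signWords↔ n false m) (signWords↔ n true (suc m)) ⟩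
  (Fin (suc n C signChanges false m) ⊎ Fin (suc n C signChanges true (suc m))) ↔⟨ Fin-pascal-↔ (suc n) (signChanges false m) ⟩
  Fin (suc (suc n) C signChanges true (suc m))                      ∎

pnDesList≡pnDesFrom : ∀ {n k} (x : Letter n) (w : Vec (Letter n) k) →
                      pnDesList (toList (x ∷ w)) ≡ pnDesFrom (proj₂ x) (map proj₂ w)
pnDesList≡pnDesFrom x []      = refl
pnDesList≡pnDesFrom x (y ∷ w) = cong ((if proj₂ x ∧ not (proj₂ y) then 1 else 0) +_) (pnDesList≡pnDesFrom y w)

pnDesList≡pnDesFrom-false : ∀ {n k} (w : Vec (Letter n) k) → pnDesList (toList w) ≡ pnDesFrom false (map proj₂ w)
pnDesList≡pnDesFrom-false []      = refl
pnDesList≡pnDesFrom-false (x ∷ w) = pnDesList≡pnDesFrom x w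

signedPerms↔ : ∀ n m →
  Σ (Vec (Letter n) n) (λ w → T (isSignedPermᵇ w) × pnDes w ≡ m) ↔ (DistinctVec n n × SignWords n false m)
signedPerms↔ n m =
  ↔-trans (Σ-↔ ↔-refl (λ {w} → ×-cong ↔-refl (K-reflexive (cong (_≡ m) (pnDesList≡pnDesFrom-false w)))))
          (Σ-unzip-↔ T-irrelevant ≡-irrelevant)

double≡2* : ∀ m → double m ≡ 2 * m
double≡2* zero    = refl
double≡2* (suc m) = trans (cong (2 +_) (double≡2* m)) (sym (*-suc 2 m))

binomShift≡ : ∀ n m → binomShift n m ≡ suc n C signChanges false m
binomShift≡ n m rewrite sym (double≡2* m) with double m ≤ᵇ n in eq
... | true  = sym (nCk≡nC[n∸k] {k = suc (double m)} {n = suc n} (s≤s (≤ᵇ⇒≤ (double m) n (subst T (sym eq) tt))))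
... | false = sym (k>n⇒nCk≡0 {suc n} {suc (double m)} (s≤s (≰⇒> (λ le → subst T eq (≤⇒≤ᵇ le)))))

proposition1 : (n m : ℕ) → n ≥ 1 →
    Fin (n ! * binomShift n m)
    ⤖ Σ (Vec (Letter n) n) (λ w → T (isSignedPermᵇ w) × pnDes w ≡ m)
proposition1 n m _ = ↔⇒⤖ (begin
  Fin (n ! * binomShift n m)                               ↔⟨ *↔× ⟩
  (Fin (n !) × Fin (binomShift n m))                       ↔⟨ ×-cong ↔-refl (Fin-cong (binomShift≡ n m)) ⟩
  (Fin (n !) × Fin (suc n C signChanges false m))          ↔⟨ ×-cong (permutations↔ n) (signWords↔ n false m) ⟨
  (DistinctVec n n × SignWords n false m)                  ↔⟨ signedPerms↔ n m ⟨
  Σ (Vec (Letter n) n) (λ w → T (isSignedPermᵇ w) × pnDes w ≡ m) ∎)
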